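{- For every natural number $n$, each $n$-configuration unit $\mathcal{U}$ is a model of the knowledge base $\mathcal{K}_{\mathrm{unit}}^{n}$, i.e. $\mathcal{U}$ satisfies every GCI of $\mathcal{K}_{\mathrm{unit}}^{n}$.
   Context: Setting: the description logic $\mathcal{ALC}^{\mathsf{Self}}$ (ALC extended with Self concepts $\exists r.\mathsf{Self}$, interpreted as $\{d \mid (d,d)\in r^{\mathcal{I}}\}$), with the usual set-theoretic semantics; $C \to D$ abbreviates $\neg C \sqcup D$ and $\forall r.C$ abbreviates $\neg\exists r.\neg C$. An interpretation satisfies a GCI $C \sqsubseteq D$ if $C^{\mathcal{I}}\subseteq D^{\mathcal{I}}$, and $C \equiv D$ stands for both inclusions. Vocabulary: role names $\mathbf{R}_{\mathrm{unit}} = \{\ell_i, r_i, \mathsf{next} \mid 1\le i\le n\}$ and concept names $\{\mathsf{Lvl}_i \mid 0\le i\le n\}\cup\{\mathsf{L},\mathsf{R}\}\cup\{\mathsf{Adr}_i^0,\mathsf{Adr}_i^1 \mid 1\le i\le n\}$. An $n$-configuration unit is an interpretation $\mathcal{U}$ with domain $\Delta^{\mathcal{U}}=\{0,1\}^{\le n}$ (binary words of length at most $n$) such that: - $(\mathsf{Adr}_i^b)^{\mathcal{U}}=\{w \mid |w|\ge i \text{ and the } i\text{ -th letter of } w \text{ is } b\}$; - $\ell_i^{\mathcal{U}}=\{(w,w0)\mid |w|=i-1\}\cup\{(w,w)\mid w\in\Delta^{\mathcal{U}}\}$ and $r_i^{\mathcal{U}}=\{(w,w1)\mid |w|=i-1\}\cup\{(w,w)\mid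 w\in\Delta^{\mathcal{U}}\}$; - $\mathsf{L}^{\mathcal{U}}\setminus\{\varepsilon\}=\{w0\in\Delta^{\mathcal{U}}\}$ and $\mathsf{R}^{\mathcal{U}}=\Delta^{\mathcal{U}}\setminus\mathsf{L}^{\mathcal{U}}$; - $\mathsf{Lvl}_i^{\mathcal{U}}=\{w\mid |w|=i\}$; - $\mathsf{next}^{\mathcal{U}}=\{(w,w)\mid |w|=n\}$. $\mathcal{K}_{\mathrm{unit}}^{n}$ consists of the following GCIs: 1. $\top \sqsubseteq \mathsf{Lvl}_0\sqcup\dots\sqcup\mathsf{Lvl}_n$; and $\mathsf{Lvl}_i\sqcap\mathsf{Lvl}_j\sqsubseteq\bot$ for $0\le i<j\le n$. 2. $\top\sqsubseteq$ the conjunction ($\sqcap$) of $\exists s.\mathsf{Self}$ over all $s\in\mathbf{R}_{\mathrm{unit}}\setminus\{\mathsf{next}\}$; and $\mathsf{Lvl}_n\equiv\exists\mathsf{next}.\mathsf{Self}$. 3. $\top\sqsubseteq\mathsf{L}\sqcup\mathsf{R}$; and $\mathsf{L}\sqcap\mathsf{R}\sqsubseteq\bot$. 4. For $0\le i<n$: $\mathsf{Lvl}_i\sqsubseteq\exists\ell_{i+1}.\mathsf{Lvl}_{i+1}\sqcap\forall\ell_{i+1}.(\mathsf{Lvl}_{i+1}\to\mathsf{L})$ and $\mathsf{Lvl}_i\sqsubseteq\exists r_{i+1}.\mathsf{Lvl}_{i+1}\sqcap\forall r_{i+1}.(\mathsf{Lvl}_{i+1}\to\mathsf{R})$. 5.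 For $1\le i\le n$, $b\in\{0,1\}$, $0\le j<i$: $\mathsf{Lvl}_i\sqcap\mathsf{L}\sqsubseteq\mathsf{Adr}_i^0$; $\mathsf{Lvl}_i\sqcap\mathsf{R}\sqsubseteq\mathsf{Adr}_i^1$; $\mathsf{Adr}_i^0\sqcap\mathsf{Adr}_i^1\sqsubseteq\bot$; $\mathsf{Adr}_i^b\sqcap\mathsf{Lvl}_j\sqsubseteq\bot$; and $\mathsf{Adr}_i^b\sqsubseteq (\forall\ell_1.\mathsf{Adr}_i^b\sqcap\forall r_1.\mathsf{Adr}_i^b)\sqcap\dots\sqcap(\forall\ell_n.\mathsf{Adr}_i^b\sqcap\forall r_n.\mathsf{Adr}_i^b)$. -}

module Defs where

open import Data.Nat using (ℕ; zero; suc; _≤_; _<_; _≤ᵇ_)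
open import Data.Fin using (Fin; toℕ; fromℕ; fromℕ<; inject₁) renaming (suc to fsuc)
open import Data.Bool using (Bool; true; false; T; if_then_else_)
open import Data.List using (List; []; _∷_; [_]; _++_; length; lookup; map; foldr; concatMap; allFin)
open import Data.List.Relation.Unary.All using (All)
open import Data.Product using (Σ; Σ-syntax; _×_; _,_; proj₁; proj₂)
open import Data.Sum using (_⊎_)
open import Data.Unit using (⊤)
open import Data.Empty using (⊥)
open import Relation.Nullary using (¬_)
open import Relation.Binary.PropositionalEquality using (_≡_)
open import Function.Bundles using (_⇔_)

data Concept (CN RN : Set) : Set where
  ⊤c    : Concept CN RN
  ⊥c    : Concept CN RN
  atom  : CN → Concept CN RN
  ¬c_   : Concept CN RN → Concept CN RN
  _⊓_   : Concept CN RN → Concept CN RN → Concept CN RN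
  _⊔_   : Concept CN RN → Concept CN RN → Concept CN RN
  ∃c[_]_ : RN → Concept CN RN → Concept CN RN
  ∃Self : RN → Concept CN RN

_⇒c_ : ∀ {CN RN} → Concept CN RN → Concept CN RN → Concept CN RN
C ⇒c D = (¬c C) ⊔ D

∀c[_]_ : ∀ {CN RN} → RN → Concept CN RN → Concept CN RN
∀c[ r ] C = ¬c (∃c[ r ] (¬c C))

record GCI (CN RN : Set) : Set where
  constructor _⊑_
  field
    lhs : Concept CN RN
    rhs : Concept CN RN

record Interpretation (CN RN : Set) (Δ : Set) : Set where
  field
    conc : CN → Δ → Bool
    role : RN → Δ → Δ → Bool

module _ {CN RN Δ : Set} (I : Interpretation CN RN Δ) where
  open Interpretation I

  ⟦_⟧ : Concept CN RN → Δ → Set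
  ⟦ ⊤c ⟧ d = ⊤
  ⟦ ⊥c ⟧ d = ⊥
  ⟦ atom A ⟧ d = T (conc A d)
  ⟦ ¬c C ⟧ d = ¬ ⟦ C ⟧ d
  ⟦ C ⊓ D ⟧ d = ⟦ C ⟧ d × ⟦ D ⟧ d
  ⟦ C ⊔ D ⟧ d = ⟦ C ⟧ d ⊎ ⟦ D ⟧ d
  ⟦ ∃c[ r ] C ⟧ d = Σ[ e ∈ Δ ] (T (role r d e) × ⟦ C ⟧ e)
  ⟦ ∃Self r ⟧ d = T (role r d d)

  Satisfies : GCI CN RN → Set
  Satisfies (C ⊑ D) = ∀ d → ⟦ C ⟧ d → ⟦ D ⟧ d

  IsModel : List (GCI CN RN) → Set
  IsModel K = All Satisfies K

-- Vocabulary.  Index conventions: for i : Fin n, ℓ i, r i, Adr i b denote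
-- the paper's ℓ_{i+1}, r_{i+1}, Adr_{i+1}^b; for i : Fin (suc n), Lvl i
-- denotes Lvl_i.

data CNUnit (n : ℕ) : Set where
  Lvl : Fin (suc n) → CNUnit n
  L R : CNUnit n
  Adr : Fin n → Bool → CNUnit n

data RNUnit (n : ℕ) : Set where
  ℓ r : Fin n → RNUnit n
  next : RNUnit n

-- domain {0,1}^{≤n}: binary words (false = 0, true = 1) of length ≤ n
Word : ℕ → Set
Word n = Σ[ w ∈ List Bool ] (length w ≤ n)

record IsUnit (n : ℕ) (U : Interpretation (CNUnit n) (RNUnit n) (Word n)) : Set where
  open Interpretation U
  field
    adr  : ∀ (i : Fin n) (b : Bool) (w : Word n) →
           T (conc (Adr i b) w) ⇔
           (Σ[ p ∈ toℕ i < length (proj₁ w) ] lookup (proj₁ w) (fromℕ< p) ≡ b)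
    ell  : ∀ (i : Fin n) (v w : Word n) →
           T (role (ℓ i) v w) ⇔
           ((length (proj₁ v) ≡ toℕ i × proj₁ w ≡ proj₁ v ++ [ false ]) ⊎ proj₁ w ≡ proj₁ v)
    rr   : ∀ (i : Fin n) (v w : Word n) →
           T (role (r i) v w) ⇔
           ((length (proj₁ v) ≡ toℕ i × proj₁ w ≡ proj₁ v ++ [ true ]) ⊎ proj₁ w ≡ proj₁ v)
    lft  : ∀ (w : Word n) → ¬ (proj₁ w ≡ []) →
           T (conc L w) ⇔ (Σ[ u ∈ List Bool ] proj₁ w ≡ u ++ [ false ])
    rgt  : ∀ (w : Word n) → T (conc R w) ⇔ (¬ T (conc L w))
    lvl  : ∀ (i : Fin (suc n)) (w : Word n) →
           T (conc (Lvl i) w) ⇔ (length (proj₁ w) ≡ toℕ i)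
    nxt  : ∀ (v w : Word n) →
           T (role next v w) ⇔ (length (proj₁ v) ≡ n × proj₁ w ≡ proj₁ v)

module KB (n : ℕ) where
  C : Set
  C = Concept (CNUnit n) (RNUnit n)

  A : CNUnit n → C
  A = atom

  ⨆ : List C → C
  ⨆ = foldr _⊔_ ⊥c

  ⨅ : List C → C
  ⨅ = foldr _⊓_ ⊤c

  _≡c_ : C → C → List (GCI (CNUnit n) (RNUnit n))
  X ≡c Y = (X ⊑ Y) ∷ (Y ⊑ X) ∷ []

  ax1 : List (GCI (CNUnit n) (RNUnit n))
  ax1 = (⊤c ⊑ ⨆ (map (λ i → A (Lvl i)) (allFin (suc n))))
      ∷ concatMap (λ i → concatMap (λ j →
          if toℕ (fsuc i) ≤ᵇ toℕ j
          then [ (A (Lvl i) ⊓ A (Lvl j)) ⊑ ⊥c ] else [])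
          (allFin (suc n))) (allFin (suc n))

  ax2 : List (GCI (CNUnit n) (RNUnit n))
  ax2 = (⊤c ⊑ ⨅ (concatMap (λ i → ∃Self (ℓ i) ∷ ∃Self (r i) ∷ []) (allFin n)))
      ∷ (A (Lvl (fromℕ n)) ≡c ∃Self next)

  ax3 : List (GCI (CNUnit n) (RNUnit n))
  ax3 = (⊤c ⊑ (A L ⊔ A R)) ∷ ((A L ⊓ A R) ⊑ ⊥c) ∷ []

  -- 4.  (i : Fin n stands for the paper's i; Lvl_{i+1} is Lvl (fsuc i))
  ax4 : List (GCI (CNUnit n) (RNUnit n))
  ax4 = concatMap (λ i →
          (A (Lvl (inject₁ i)) ⊑
             ((∃c[ ℓ i ] A (Lvl (fsuc i))) ⊓ (∀c[ ℓ i ] (A (Lvl (fsuc i)) ⇒c A L))))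
        ∷ (A (Lvl (inject₁ i)) ⊑
             ((∃c[ r i ] A (Lvl (fsuc i))) ⊓ (∀c[ r i ] (A (Lvl (fsuc i)) ⇒c A R))))
        ∷ []) (allFin n)

  -- 5.  (i : Fin n stands for the paper's i+1 ∈ {1..n})
  bools : List Bool
  bools = false ∷ true ∷ []

  ax5 : List (GCI (CNUnit n) (RNUnit n))
  ax5 = concatMap (λ i →
          ((A (Lvl (fsuc i)) ⊓ A L) ⊑ A (Adr i false))
        ∷ ((A (Lvl (fsuc i)) ⊓ A R) ⊑ A (Adr i true))
        ∷ ((A (Adr i false) ⊓ A (Adr i true)) ⊑ ⊥c)
        ∷ concatMap (λ b →
            concatMap (λ j →
              if toℕ j ≤ᵇ toℕ i
              then [ (A (Adr i b) ⊓ A (Lvl j)) ⊑ ⊥c ] else [])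
              (allFin (suc n))
            ++ [ A (Adr i b) ⊑
                 ⨅ (map (λ k → (∀c[ ℓ k ] A (Adr i b)) ⊓ (∀c[ r k ] A (Adr i b)))
                        (allFin n)) ])
          bools) (allFin n)

  K-unit : List (GCI (CNUnit n) (RNUnit n))
  K-unit = ax1 ++ ax2 ++ ax3 ++ ax4 ++ ax5

-- Every axiom is a direct reading of the defining clauses of a unit: Lvl_i is
-- "length i", L and R read off the last letter, Adr_i^b reads the i-th letter,
-- and ℓ_k, r_k either stay put or append one letter.  The only step that is
-- not purely local is the propagation axiom for Adr_i^b, which holds because
-- appending letters never changes an existing position.
module Submission where

open import Defs
open import Data.Nat using (ℕ; zero; suc; z≤n; _<_; _≤_; _≤ᵇ_; s≤s)
open import Data.Nat.Properties using (≤ᵇ⇒≤; <⇒≢; ≤⇒≯; suc-injective; +-comm; 1+n≢n)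
open import Data.Fin using (Fin; toℕ; fromℕ<; inject₁) renaming (suc to fsuc)
open import Data.Fin.Properties using (toℕ-fromℕ; toℕ-fromℕ<; toℕ-inject₁; toℕ<n)
open import Data.Bool using (Bool; true; false; T; if_then_else_)
open import Data.Bool.Properties using (T?; ¬-not)
open import Function using (case_of_)
open import Data.List using (List; []; _∷_; [_]; _++_; _∷ʳ_; length; lookup; map; concatMap; allFin; initLast; _∷ʳ′_)
open import Data.List.Properties using (length-++; ++-identityʳ; ∷ʳ-injectiveʳ)
open import Data.List.Relation.Unary.All using (All; []; _∷_; universal)
open import Data.List.Relation.Unary.All.Properties using (++⁺; concat⁺; map⁺)
open import Data.List.Relation.Unary.Any using (here; there)
open import Data.List.Membership.Propositional using (_∈_)
open import Data.List.Membership.Propositional.Properties using (∈-allFin)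
open import Data.Product using (Σ-syntax; ∃-syntax; _×_; _,_; proj₁; proj₂)
open import Data.Sum using (_⊎_; inj₁; inj₂)
open import Data.Unit using (tt)
open import Relation.Nullary using (yes; no)
open import Relation.Binary.PropositionalEquality using (_≡_; _≢_; refl; sym; trans; cong; subst)
open import Function.Bundles using (Equivalence; _⇔_)

open Equivalence

concatMap⁺ : ∀ {A B : Set} {P : B → Set} {f : A → List B} →
             (∀ x → All P (f x)) → ∀ xs → All P (concatMap f xs)
concatMap⁺ h xs = concat⁺ (map⁺ (universal h xs))

if-singleton⁺ : ∀ {A : Set} {P : A → Set} b {x : A} → (T b → P x) → All P (if b then [ x ] else [])
if-singleton⁺ false h = []
if-singleton⁺ true  h = h tt ∷ []

length-∷ʳ : ∀ {A : Set} (xs : List A) x → length (xs ∷ʳ x) ≡ suc (length xs)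
length-∷ʳ xs x = trans (length-++ xs) (+-comm (length xs) 1)

_[_]≡_ : ∀ {A : Set} → List A → ℕ → A → Set
xs [ i ]≡ x = Σ[ p ∈ i < length xs ] lookup xs (fromℕ< p) ≡ x

[]≡-++ʳ : ∀ {A : Set} (xs ys : List A) {i x} → xs [ i ]≡ x → (xs ++ ys) [ i ]≡ x
[]≡-++ʳ (x ∷ xs) ys {zero}  (_ , e)     = s≤s z≤n , e
[]≡-++ʳ (x ∷ xs) ys {suc i} (s≤s p , e) with []≡-++ʳ xs ys (p , e)
... | q , e′ = s≤s q , e′

∷ʳ-[length]≡ : ∀ {A : Set} (xs : List A) x → (xs ∷ʳ x) [ length xs ]≡ x
∷ʳ-[length]≡ []       x = s≤s z≤n , refl
∷ʳ-[length]≡ (y ∷ xs) x with ∷ʳ-[length]≡ xs x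
... | p , e = s≤s p , e

[]≡-functional : ∀ {A : Set} (xs : List A) {i x y} → xs [ i ]≡ x → xs [ i ]≡ y → x ≡ y
[]≡-functional _ (_ , ex) (_ , ey) = trans (sym ex) ey

stay-or-append⇒extends : ∀ {A : Set} {Q : Set} {v e : List A} {c} →
                  (Q × e ≡ v ∷ʳ c) ⊎ e ≡ v → ∃[ ys ] e ≡ v ++ ys
stay-or-append⇒extends (inj₁ (_ , e≡vc)) = _ , e≡vc
stay-or-append⇒extends {v = v} (inj₂ e≡v) = [] , trans e≡v (sym (++-identityʳ v))

snoc-of-length-suc : ∀ {A : Set} (w : List A) {k} → length w ≡ suc k →
                     ∃[ u ] ∃[ b ] w ≡ u ∷ʳ b × length u ≡ k
snoc-of-length-suc w e with initLast w
... | u ∷ʳ′ b = u , b , refl , suc-injective (trans (sym (length-∷ʳ u b)) e)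

∷ʳ≢[] : ∀ {A : Set} (u : List A) x → u ∷ʳ x ≢ []
∷ʳ≢[] []      x ()
∷ʳ≢[] (_ ∷ _) x ()

module _ {n : ℕ} {Δ : Set} (I : Interpretation (CNUnit n) (RNUnit n) Δ) where
  open KB n

  ⨆-map-intro : ∀ {X : Set} (f : X → C) {xs x d} → x ∈ xs → ⟦ I ⟧ (f x) d → ⟦ I ⟧ (⨆ (map f xs)) d
  ⨆-map-intro f (here refl) h = inj₁ h
  ⨆-map-intro f (there x∈) h = inj₂ (⨆-map-intro f x∈ h)

  ⨅-intro : ∀ {Cs d} → All (λ C → ⟦ I ⟧ C d) Cs → ⟦ I ⟧ (⨅ Cs) d
  ⨅-intro []       = tt
  ⨅-intro (h ∷ hs) = h , ⨅-intro hs

module UnitModel {n : ℕ} {U : Interpretation (CNUnit n) (RNUnit n) (Word n)} (isU : IsUnit n U) where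
  open Interpretation U
  open IsUnit isU
  open KB n

  ⟪_⟫ : C → Word n → Set
  ⟪_⟫ = ⟦ U ⟧

  level : ∀ {i} (w : Word n) → ⟪ A (Lvl i) ⟫ w → length (proj₁ w) ≡ toℕ i
  level w = to (lvl _ w)

  level⁺ : ∀ {i} (w : Word n) → length (proj₁ w) ≡ toℕ i → ⟪ A (Lvl i) ⟫ w
  level⁺ w = from (lvl _ w)

  module _ (w : Word n) {u : List Bool} {b : Bool} (w≡ub : proj₁ w ≡ u ∷ʳ b) where

    nonempty : proj₁ w ≢ []
    nonempty w≡[] = ∷ʳ≢[] u b (trans (sym w≡ub) w≡[])

    L-last : ⟪ A L ⟫ w → b ≡ false
    L-last inL with to (lft w nonempty) inL
    ... | u′ , w≡u′0 = ∷ʳ-injectiveʳ u u′ (trans (sym w≡ub) w≡u′0)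

    last-L : b ≡ false → ⟪ A L ⟫ w
    last-L refl = from (lft w nonempty) (u , w≡ub)

    R-last : ⟪ A R ⟫ w → b ≡ true
    R-last inR = ¬-not (λ b≡0 → to (rgt w) inR (last-L b≡0))

    last-R : b ≡ true → ⟪ A R ⟫ w
    last-R refl = from (rgt w) (λ inL → case L-last inL of λ ())

    Adr-last : ∀ {i} → length u ≡ toℕ i → ⟪ A (Adr i b) ⟫ w
    Adr-last {i} |u|≡i = from (adr i b w)
      (subst (_[ toℕ i ]≡ b) (sym w≡ub) (subst ((u ∷ʳ b) [_]≡ b) |u|≡i (∷ʳ-[length]≡ u b)))

  Adr-position : ∀ {i b} (w : Word n) → ⟪ A (Adr i b) ⟫ w → toℕ i < length (proj₁ w)
  Adr-position w h = proj₁ (to (adr _ _ w) h)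

  Adr-++ : ∀ {i b} (v e : Word n) {ys} → proj₁ e ≡ proj₁ v ++ ys → ⟪ A (Adr i b) ⟫ v → ⟪ A (Adr i b) ⟫ e
  Adr-++ v e {ys} e≡vys h =
    from (adr _ _ e) (subst (_[ _ ]≡ _) (sym e≡vys) ([]≡-++ʳ (proj₁ v) ys (to (adr _ _ v) h)))

  Adr-last-of-level : ∀ {i c} (w : Word n) → length (proj₁ w) ≡ suc (toℕ i) →
                      (∀ {u b} → proj₁ w ≡ u ∷ʳ b → b ≡ c) → ⟪ A (Adr i c) ⟫ w
  Adr-last-of-level {i} w |w|≡1+i last≡c with snoc-of-length-suc (proj₁ w) |w|≡1+i
  ... | u , b , w≡ub , |u|≡i = subst (λ c → ⟪ A (Adr i c) ⟫ w) (last≡c w≡ub) (Adr-last w w≡ub |u|≡i)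

  Adr-∀-closed : ∀ {i b} (s : RNUnit n) (w : Word n) →
                 (∀ e → T (role s w e) → ∃[ ys ] proj₁ e ≡ proj₁ w ++ ys) →
                 ⟪ A (Adr i b) ⟫ w → ⟪ ∀c[ s ] A (Adr i b) ⟫ w
  Adr-∀-closed s w extends h (e , se , ¬Adr) = ¬Adr (Adr-++ w e (proj₂ (extends e se)) h)

  child-axiom : ∀ (i : Fin n) (s : RNUnit n) (c : Bool) (X : CNUnit n) →
    (∀ v e → T (role s v e) ⇔
             ((length (proj₁ v) ≡ toℕ i × proj₁ e ≡ proj₁ v ∷ʳ c) ⊎ proj₁ e ≡ proj₁ v)) →
    (∀ e {u} → proj₁ e ≡ u ∷ʳ c → ⟪ A X ⟫ e) →
    Satisfies U (A (Lvl (inject₁ i)) ⊑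
                 ((∃c[ s ] A (Lvl (fsuc i))) ⊓ (∀c[ s ] (A (Lvl (fsuc i)) ⇒c A X))))
  child-axiom i s c X spec X-last w h =
    (child , from (spec w child) (inj₁ (|w|≡i , refl)) , level⁺ child |child|≡1+i) , successors
    where
    |w|≡i : length (proj₁ w) ≡ toℕ i
    |w|≡i = trans (level w h) (toℕ-inject₁ i)

    |child|≡1+i : length (proj₁ w ∷ʳ c) ≡ suc (toℕ i)
    |child|≡1+i = trans (length-∷ʳ (proj₁ w) c) (cong suc |w|≡i)

    child : Word n
    child = proj₁ w ∷ʳ c , subst (_≤ n) (sym |child|≡1+i) (toℕ<n i)

    successors : ⟪ ∀c[ s ] (A (Lvl (fsuc i)) ⇒c A X) ⟫ w
    successors (e , se , ¬impl) with to (spec w e) se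
    ... | inj₁ (_ , e≡wc) = ¬impl (inj₂ (X-last e e≡wc))
    ... | inj₂ e≡w = ¬impl (inj₁ λ e∈Lvl →
            1+n≢n (trans (sym (level e e∈Lvl)) (trans (cong length e≡w) |w|≡i)))

  ax1-valid : All (Satisfies U) ax1
  ax1-valid = (λ w _ → ⨆-map-intro U (λ i → A (Lvl i)) (∈-allFin _)
                         (level⁺ w (sym (toℕ-fromℕ< (s≤s (proj₂ w))))))
            ∷ concatMap⁺ (λ i → concatMap⁺ (λ j → if-singleton⁺ _ (levels-disjoint i j))
                                           (allFin (suc n)))
                         (allFin (suc n))
    where
    levels-disjoint : ∀ i j → T (toℕ (fsuc i) ≤ᵇ toℕ j) → Satisfies U ((A (Lvl i) ⊓ A (Lvl j)) ⊑ ⊥c)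
    levels-disjoint i j i<j w (w∈i , w∈j) =
      <⇒≢ (≤ᵇ⇒≤ _ _ i<j) (trans (sym (level w w∈i)) (level w w∈j))

  ax2-valid : All (Satisfies U) ax2
  ax2-valid = (λ w _ → ⨅-intro U (concatMap⁺ (λ i → from (ell i w w) (inj₂ refl)
                                                   ∷ from (rr i w w) (inj₂ refl) ∷ [])
                                              (allFin n)))
            ∷ (λ w h → from (nxt w w) (trans (level w h) (toℕ-fromℕ n) , refl))
            ∷ (λ w h → level⁺ w (trans (proj₁ (to (nxt w w) h)) (sym (toℕ-fromℕ n))))
            ∷ []

  ax3-valid : All (Satisfies U) ax3
  ax3-valid = (λ w _ → L⊎R w) ∷ (λ w (inL , inR) → to (rgt w) inR inL) ∷ []
    where
    L⊎R : ∀ w → ⟪ A L ⊔ A R ⟫ w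
    L⊎R w with T? (conc L w)
    ... | yes inL = inj₁ inL
    ... | no ¬inL = inj₂ (from (rgt w) ¬inL)

  ax4-valid : All (Satisfies U) ax4
  ax4-valid = concatMap⁺ (λ i → child-axiom i (ℓ i) false L (ell i) (λ e e≡ → last-L e e≡ refl)
                              ∷ child-axiom i (r i) true  R (rr i)  (λ e e≡ → last-R e e≡ refl)
                              ∷ [])
                         (allFin n)

  ax5-valid : All (Satisfies U) ax5
  ax5-valid = concatMap⁺ (λ i →
                Lvl∧L⇒Adr0 i ∷ Lvl∧R⇒Adr1 i ∷ Adr-disjoint i
              ∷ concatMap⁺ (Adr-letter-axioms i) bools)
              (allFin n)
    where
    Lvl∧L⇒Adr0 : ∀ i → Satisfies U ((A (Lvl (fsuc i)) ⊓ A L) ⊑ A (Adr i false))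
    Lvl∧L⇒Adr0 i w (w∈Lvl , inL) = Adr-last-of-level w (level w w∈Lvl) (λ w≡ → L-last w w≡ inL)

    Lvl∧R⇒Adr1 : ∀ i → Satisfies U ((A (Lvl (fsuc i)) ⊓ A R) ⊑ A (Adr i true))
    Lvl∧R⇒Adr1 i w (w∈Lvl , inR) = Adr-last-of-level w (level w w∈Lvl) (λ w≡ → R-last w w≡ inR)

    Adr-disjoint : ∀ i → Satisfies U ((A (Adr i false) ⊓ A (Adr i true)) ⊑ ⊥c)
    Adr-disjoint i w (h₀ , h₁) =
      case []≡-functional (proj₁ w) (to (adr i false w) h₀) (to (adr i true w) h₁) of λ ()

    Adr-above-level : ∀ i b j → T (toℕ j ≤ᵇ toℕ i) → Satisfies U ((A (Adr i b) ⊓ A (Lvl j)) ⊑ ⊥c)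
    Adr-above-level i b j j≤i w (w∈Adr , w∈Lvl) =
      ≤⇒≯ (≤ᵇ⇒≤ _ _ j≤i) (subst (toℕ i <_) (level w w∈Lvl) (Adr-position w w∈Adr))

    Adr-∀ℓr : ∀ i b → Satisfies U (A (Adr i b) ⊑
                 ⨅ (map (λ k → (∀c[ ℓ k ] A (Adr i b)) ⊓ (∀c[ r k ] A (Adr i b))) (allFin n)))
    Adr-∀ℓr i b w h = ⨅-intro U (map⁺ (universal (λ k →
        Adr-∀-closed (ℓ k) w (λ e se → stay-or-append⇒extends (to (ell k w e) se)) h ,
        Adr-∀-closed (r k) w (λ e se → stay-or-append⇒extends (to (rr k w e) se)) h)
      (allFin n)))

    Adr-letter-axioms : ∀ i b → All (Satisfies U)
      (concatMap (λ j → if toℕ j ≤ᵇ toℕ i then [ (A (Adr i b) ⊓ A (Lvl j)) ⊑ ⊥c ] else [])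
                 (allFin (suc n))
       ++ [ A (Adr i b) ⊑ ⨅ (map (λ k → (∀c[ ℓ k ] A (Adr i b)) ⊓ (∀c[ r k ] A (Adr i b))) (allFin n)) ])
    Adr-letter-axioms i b =
      ++⁺ (concatMap⁺ (λ j → if-singleton⁺ _ (Adr-above-level i b j)) (allFin (suc n)))
          (Adr-∀ℓr i b ∷ [])

lemma1 : (n : ℕ) (U : Interpretation (CNUnit n) (RNUnit n) (Word n)) →
    IsUnit n U → IsModel U (KB.K-unit n)
lemma1 n U isU = ++⁺ ax1-valid (++⁺ ax2-valid (++⁺ ax3-valid (++⁺ ax4-valid ax5-valid)))
  where open UnitModel isU
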